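{- Let $\mathbf H=\langle H,\wedge,\vee,\Rightarrow,0,1\rangle$ be a Heyting algebra, let $\neg a:=a\Rightarrow 0$, and define $a\rightarrow b:=(a\Rightarrow b)\wedge(\neg a\Rightarrow\neg b)$ for $a,b\in H$. Then $\mathbb{C}(\mathbf H)=\langle H,\wedge,\vee,\rightarrow,0,1\rangle$ is a connexive Heyting algebra.
   Context: A connexive Heyting algebra is an algebra $\mathbf A=\langle A,\wedge,\vee,\rightarrow,0,1\rangle$ of type $\langle 2,2,2,0,0\rangle$ such that $\langle A,\wedge,\vee,0,1\rangle$ is a bounded distributive lattice with bottom $0$, top $1$ and lattice order $\le$, and, writing $\neg x:=x\rightarrow 0$ (in that algebra), the following hold for all elements: (C1) $(x\rightarrow y)\rightarrow((y\rightarrow z)\rightarrow(x\rightarrow z))=1$; (C2) $(x\rightarrow y)\rightarrow\neg(x\rightarrow\neg y)=1$; (C3) $x\wedge(x\rightarrow y)=x\wedge y$; (C4) $x\rightarrow y\le(z\wedge x)\rightarrow(z\wedge y)$; (C5) $x\rightarrow y\le(z\vee x)\rightarrow(z\vee y)$. -}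

module Defs where

open import Level using (Level; _⊔_)
open import Relation.Binary.Core using (Rel)
open import Algebra.Core using (Op₂)
open import Relation.Binary.Lattice.Structures using (IsDistributiveLattice)
open import Relation.Binary.Definitions using (Maximum; Minimum)
open import Relation.Binary.Lattice.Bundles using (HeytingAlgebra)

record IsConnexiveHeytingAlgebra {a ℓ₁ ℓ₂} {A : Set a}
         (_≈_ : Rel A ℓ₁) (_≤_ : Rel A ℓ₂)
         (_∧_ _∨_ _⟶_ : Op₂ A) (𝟎 𝟏 : A) : Set (a ⊔ ℓ₁ ⊔ ℓ₂) where
  ¬_ : A → A
  ¬ x = x ⟶ 𝟎
  field
    isDistributiveLattice : IsDistributiveLattice _≈_ _≤_ _∨_ _∧_
    maximum : Maximum _≤_ 𝟏
    minimum : Minimum _≤_ 𝟎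
    C1 : ∀ x y z → ((x ⟶ y) ⟶ ((y ⟶ z) ⟶ (x ⟶ z))) ≈ 𝟏
    C2 : ∀ x y → ((x ⟶ y) ⟶ (¬ (x ⟶ (¬ y)))) ≈ 𝟏
    C3 : ∀ x y → (x ∧ (x ⟶ y)) ≈ (x ∧ y)
    C4 : ∀ x y z → (x ⟶ y) ≤ ((z ∧ x) ⟶ (z ∧ y))
    C5 : ∀ x y z → (x ⟶ y) ≤ ((z ∨ x) ⟶ (z ∨ y))

module _ {c ℓ₁ ℓ₂ : Level} (H : HeytingAlgebra c ℓ₁ ℓ₂) where
  open HeytingAlgebra H

  ¬ᴴ_ : Carrier → Carrier
  ¬ᴴ a = a ⇨ ⊥

  connexiveArrow : Op₂ Carrier
  connexiveArrow a b = (a ⇨ b) ∧ ((¬ᴴ a) ⇨ (¬ᴴ b))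

{-# OPTIONS --safe #-}
module Submission where

open import Defs
open import Relation.Binary.Lattice.Bundles using (HeytingAlgebra)
import Relation.Binary.Lattice.Properties.HeytingAlgebra as HeytingAlgebraProperties

-- Read  w ≤ φ  as a sequent with context w.  Then ⇨, ∧, ∨ and ¬ obey the rules of
-- intuitionistic natural deduction, and a ⟶ b = (a ⇨ b) ∧ (¬ a ⇨ ¬ b) has introduction and
-- elimination rules for its positive and its negative half.  The positive halves of (C1)-(C5)
-- are direct derivations.  The negative halves of (C1) and (C2) only ask for double negations
-- (¬ A ≤ ¬ B iff B ≤ ¬ ¬ A), and below ⊥ excluded middle is available; so there ⟶ behaves
-- like the Boolean biconditional, for which both axioms are tautologies.

module HeytingSequents {c ℓ₁ ℓ₂} (H : HeytingAlgebra c ℓ₁ ℓ₂) where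
  open HeytingAlgebra H
  open HeytingAlgebraProperties H using (¬_; ⇨ˡ-contravariant; ∧-distribˡ-∨-≤)

  private variable w a b p : Carrier

  assumption : w ∧ a ≤ a
  assumption = x∧y≤y _ _

  weaken : w ≤ a → w ∧ b ≤ a
  weaken w≤a = trans (x∧y≤x _ _) w≤a

  ∧-elimˡ : w ≤ a ∧ b → w ≤ a
  ∧-elimˡ w≤a∧b = trans w≤a∧b (x∧y≤x _ _)

  ∧-elimʳ : w ≤ a ∧ b → w ≤ b
  ∧-elimʳ w≤a∧b = trans w≤a∧b (x∧y≤y _ _)

  ∨-elim : w ∧ a ≤ p → w ∧ b ≤ p → w ∧ (a ∨ b) ≤ p
  ∨-elim ifA ifB = trans (∧-distribˡ-∨-≤ _ _ _) (∨-least ifA ifB)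

  ⇨-elim : w ≤ a ⇨ b → w ≤ a → w ≤ b
  ⇨-elim w≤a⇨b w≤a = trans (∧-greatest w≤a⇨b w≤a) (transpose-∧ refl)

  ¬-intro : w ∧ a ≤ ⊥ → w ≤ ¬ a
  ¬-intro = transpose-⇨

  ¬-elim : w ≤ ¬ a → w ≤ a → w ≤ ⊥
  ¬-elim = ⇨-elim

  explosion : w ≤ ⊥ → w ≤ a
  explosion w≤⊥ = trans w≤⊥ (minimum _)

  by-cases : ∀ p → w ∧ p ≤ ⊥ → w ∧ ¬ p ≤ ⊥ → w ≤ ⊥
  by-cases p ifP ifNotP = ¬-elim (¬-intro ifNotP) (¬-intro ifP)

  ¬∧-elim : w ≤ ¬ (a ∧ b) → w ≤ a → w ≤ ¬ b
  ¬∧-elim w≤¬a∧b w≤a = ¬-intro (¬-elim (weaken w≤¬a∧b) (∧-greatest (weaken w≤a) assumption))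

  ¬∨-intro : w ≤ ¬ a → w ≤ ¬ b → w ≤ ¬ (a ∨ b)
  ¬∨-intro w≤¬a w≤¬b =
    ¬-intro (∨-elim (¬-elim (weaken w≤¬a) assumption) (¬-elim (weaken w≤¬b) assumption))

  ¬∨-elimˡ : w ≤ ¬ (a ∨ b) → w ≤ ¬ a
  ¬∨-elimˡ w≤¬a∨b = trans w≤¬a∨b (⇨ˡ-contravariant (x≤x∨y _ _))

  ¬∨-elimʳ : w ≤ ¬ (a ∨ b) → w ≤ ¬ b
  ¬∨-elimʳ w≤¬a∨b = trans w≤¬a∨b (⇨ˡ-contravariant (y≤x∨y _ _))

module ConnexiveArrow {c ℓ₁ ℓ₂} (H : HeytingAlgebra c ℓ₁ ℓ₂) where
  open HeytingAlgebra H
  open HeytingAlgebraProperties H using (¬_)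
  open HeytingSequents H

  infixr 5 _⟶_
  infix 8 ∼_

  _⟶_ : Carrier → Carrier → Carrier
  _⟶_ = connexiveArrow H

  ∼_ : Carrier → Carrier
  ∼ a = a ⟶ ⊥

  private variable w a b d : Carrier

  ⟶-intro : w ∧ a ≤ b → w ∧ ¬ a ≤ ¬ b → w ≤ a ⟶ b
  ⟶-intro ifA ifNotA = ∧-greatest (transpose-⇨ ifA) (transpose-⇨ ifNotA)

  ⟶-elim : w ≤ a ⟶ b → w ≤ a → w ≤ b
  ⟶-elim w≤a⟶b = ⇨-elim (∧-elimˡ w≤a⟶b)

  ⟶-elim¬ : w ≤ a ⟶ b → w ≤ ¬ a → w ≤ ¬ b
  ⟶-elim¬ w≤a⟶b = ⇨-elim (∧-elimʳ w≤a⟶b)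

  ⟶-both : w ≤ a → w ≤ b → w ≤ a ⟶ b
  ⟶-both w≤a w≤b = ⟶-intro (weaken w≤b) (explosion (¬-elim assumption (weaken w≤a)))

  ⟶-neither : w ≤ ¬ a → w ≤ ¬ b → w ≤ a ⟶ b
  ⟶-neither w≤¬a w≤¬b = ⟶-intro (explosion (¬-elim (weaken w≤¬a) assumption)) (weaken w≤¬b)

  ⟶-contrapose : w ≤ a ⟶ b → w ≤ ¬ b → w ≤ ¬ a
  ⟶-contrapose w≤a⟶b w≤¬b = ¬-intro (¬-elim (weaken w≤¬b) (⟶-elim (weaken w≤a⟶b) assumption))

  ⟶-contrapose¬ : w ≤ a ⟶ b → w ≤ b → w ≤ ¬ ¬ a
  ⟶-contrapose¬ w≤a⟶b w≤b = ¬-intro (¬-elim (⟶-elim¬ (weaken w≤a⟶b) assumption) (weaken w≤b))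

  ⟶-elim¬¬ : w ≤ a ⟶ b → w ≤ ¬ ¬ a → w ≤ ¬ ¬ b
  ⟶-elim¬¬ w≤a⟶b w≤¬¬a = ¬-intro (¬-elim (weaken w≤¬¬a) (⟶-contrapose (weaken w≤a⟶b) assumption))

  ⟶-trans : w ≤ a ⟶ b → w ≤ b ⟶ d → w ≤ a ⟶ d
  ⟶-trans w≤a⟶b w≤b⟶d =
    ⟶-intro (⟶-elim (weaken w≤b⟶d) (⟶-elim (weaken w≤a⟶b) assumption))
            (⟶-elim¬ (weaken w≤b⟶d) (⟶-elim¬ (weaken w≤a⟶b) assumption))

  ¬⟶-elim : w ≤ ¬ (a ⟶ b) → w ≤ a → w ≤ ¬ b
  ¬⟶-elim w≤¬a⟶b w≤a = ¬-intro (¬-elim (weaken w≤¬a⟶b) (⟶-both (weaken w≤a) assumption))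

  ¬⟶-elim¬ : w ≤ ¬ (a ⟶ b) → w ≤ ¬ a → w ≤ ¬ ¬ b
  ¬⟶-elim¬ w≤¬a⟶b w≤¬a = ¬-intro (¬-elim (weaken w≤¬a⟶b) (⟶-neither (weaken w≤¬a) assumption))

  ¬⟶-contrapose : w ≤ ¬ (a ⟶ b) → w ≤ ¬ b → w ≤ ¬ ¬ a
  ¬⟶-contrapose w≤¬a⟶b w≤¬b = ¬-intro (¬-elim (weaken w≤¬a⟶b) (⟶-neither assumption (weaken w≤¬b)))

  ¬¬⟶-intro : w ∧ a ≤ ¬ ¬ b → w ∧ ¬ a ≤ ¬ b → w ≤ ¬ ¬ (a ⟶ b)
  ¬¬⟶-intro {a = a} ifA ifNotA = ¬-intro (by-cases a
    (¬-elim (⇨-elim (weaken (weaken (transpose-⇨ ifA))) assumption)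
            (¬⟶-elim (weaken assumption) assumption))
    (¬-elim (¬⟶-elim¬ (weaken assumption) assumption)
            (⇨-elim (weaken (weaken (transpose-⇨ ifNotA))) assumption)))

  ⟶-shared-antecedent : w ≤ a ⟶ b → w ≤ a ⟶ d → w ≤ ¬ ¬ (b ⟶ d)
  ⟶-shared-antecedent w≤a⟶b w≤a⟶d = ¬¬⟶-intro
    (⟶-elim¬¬ (weaken w≤a⟶d) (⟶-contrapose¬ (weaken w≤a⟶b) assumption))
    (⟶-elim¬ (weaken w≤a⟶d) (⟶-contrapose (weaken w≤a⟶b) assumption))

  ⟶-shared-consequent : w ≤ a ⟶ d → w ≤ b ⟶ d → w ≤ ¬ ¬ (a ⟶ b)
  ⟶-shared-consequent w≤a⟶d w≤b⟶d = ¬¬⟶-intro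
    (⟶-contrapose¬ (weaken w≤b⟶d) (⟶-elim (weaken w≤a⟶d) assumption))
    (⟶-contrapose (weaken w≤b⟶d) (⟶-elim¬ (weaken w≤a⟶d) assumption))

  ¬⟶-shared-consequent : w ≤ ¬ (a ⟶ d) → w ≤ ¬ (b ⟶ d) → w ≤ ¬ ¬ (a ⟶ b)
  ¬⟶-shared-consequent w≤¬a⟶d w≤¬b⟶d = ¬¬⟶-intro
    (¬⟶-contrapose (weaken w≤¬b⟶d) (¬⟶-elim (weaken w≤¬a⟶d) assumption))
    (¬-intro (¬-elim (weaken (weaken w≤¬a⟶d))
                     (⟶-neither (weaken assumption) (¬⟶-elim (weaken (weaken w≤¬b⟶d)) assumption))))

  ∼-intro : w ≤ ¬ a → w ≤ ∼ a
  ∼-intro w≤¬a = ⟶-intro (¬-elim (weaken w≤¬a) assumption) (¬-intro assumption)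

  ∼-elim : w ≤ ∼ a → w ≤ ¬ a
  ∼-elim = ∧-elimˡ

  ⟶≈⊤ : a ≤ b → ¬ a ≤ ¬ b → a ⟶ b ≈ ⊤
  ⟶≈⊤ a≤b ¬a≤¬b = antisym (maximum _) (⟶-intro (trans assumption a≤b) (trans assumption ¬a≤¬b))

  ⟶-syllogism : ∀ a b d → (a ⟶ b) ⟶ (b ⟶ d) ⟶ (a ⟶ d) ≈ ⊤
  ⟶-syllogism a b d = ⟶≈⊤ forward backward
    where
    forward : a ⟶ b ≤ (b ⟶ d) ⟶ (a ⟶ d)
    forward = ⟶-intro (⟶-trans (weaken refl) assumption)
      (¬-intro (¬-elim (⟶-shared-antecedent (weaken (weaken refl)) assumption) (weaken assumption)))

    backward : ¬ (a ⟶ b) ≤ ¬ ((b ⟶ d) ⟶ (a ⟶ d))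
    backward = ¬-intro (by-cases (b ⟶ d)
      (¬-elim (⟶-shared-consequent (⟶-elim (weaken assumption) assumption) assumption)
              (weaken (weaken refl)))
      (¬-elim (¬⟶-shared-consequent (⟶-elim¬ (weaken assumption) assumption) assumption)
              (weaken (weaken refl))))

  ⟶-boethius : ∀ a b → (a ⟶ b) ⟶ ∼ (a ⟶ ∼ b) ≈ ⊤
  ⟶-boethius a b = ⟶≈⊤ forward backward
    where
    forward : a ⟶ b ≤ ∼ (a ⟶ ∼ b)
    forward = ∼-intro (¬-intro (by-cases a
      (¬-elim (∼-elim (⟶-elim (weaken assumption) assumption))
              (⟶-elim (weaken (weaken refl)) assumption))
      (¬-elim (⟶-elim¬ (weaken assumption) assumption)
              (∼-intro (⟶-elim¬ (weaken (weaken refl)) assumption)))))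

    backward : ¬ (a ⟶ b) ≤ ¬ ∼ (a ⟶ ∼ b)
    backward = ¬-intro (by-cases a
      (¬-elim (∼-elim (weaken assumption))
              (⟶-both assumption (∼-intro (¬⟶-elim (weaken (weaken refl)) assumption))))
      (¬-elim (∼-elim (weaken assumption))
              (⟶-neither assumption
                (¬-intro (¬-elim (weaken (¬⟶-elim¬ (weaken (weaken refl)) assumption))
                                 (∼-elim assumption))))))

  ∧-⟶-app : ∀ a b → a ∧ (a ⟶ b) ≈ a ∧ b
  ∧-⟶-app a b = antisym
    (∧-greatest (x∧y≤x _ _) (⟶-elim assumption (x∧y≤x _ _)))
    (∧-greatest (x∧y≤x _ _) (⟶-both (x∧y≤x _ _) assumption))

  ⟶-∧-compatible : ∀ a b d → a ⟶ b ≤ (d ∧ a) ⟶ (d ∧ b)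
  ⟶-∧-compatible a b d = ⟶-intro
    (∧-greatest (∧-elimˡ assumption) (⟶-elim (weaken refl) (∧-elimʳ assumption)))
    (¬-intro (¬-elim (⟶-elim¬ (weaken (weaken refl)) (¬∧-elim (weaken assumption) (∧-elimˡ assumption)))
                     (∧-elimʳ assumption)))

  ⟶-∨-compatible : ∀ a b d → a ⟶ b ≤ (d ∨ a) ⟶ (d ∨ b)
  ⟶-∨-compatible a b d = ⟶-intro
    (∨-elim (trans assumption (x≤x∨y _ _)) (trans (⟶-elim (weaken refl) assumption) (y≤x∨y _ _)))
    (¬∨-intro (¬∨-elimˡ assumption) (⟶-elim¬ (weaken refl) (¬∨-elimʳ assumption)))

theorem3p14 : ∀ {c ℓ₁ ℓ₂} (H : HeytingAlgebra c ℓ₁ ℓ₂) →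
    IsConnexiveHeytingAlgebra (HeytingAlgebra._≈_ H) (HeytingAlgebra._≤_ H)
      (HeytingAlgebra._∧_ H) (HeytingAlgebra._∨_ H) (connexiveArrow H)
      (HeytingAlgebra.⊥ H) (HeytingAlgebra.⊤ H)
theorem3p14 H = record
  { isDistributiveLattice = isDistributiveLattice
  ; maximum = maximum
  ; minimum = minimum
  ; C1 = ⟶-syllogism
  ; C2 = ⟶-boethius
  ; C3 = ∧-⟶-app
  ; C4 = ⟶-∧-compatible
  ; C5 = ⟶-∨-compatible
  }
  where
  open HeytingAlgebra H using (maximum; minimum)
  open HeytingAlgebraProperties H using (isDistributiveLattice)
  open ConnexiveArrow H
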